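{- Let $p$ be an odd prime and $a\in\mathbb{F}_p$ with $a\notin\{0,1,\tfrac12\}$. Then exactly one of the following holds, and it determines the Legendre symbols as indicated: if $A_2(a)=1$ or $A_2(a)=-1$, then $\left(\frac{a}{p}\right)=\left(\frac{1-a}{p}\right)=1$; if $A_2(a)=0$, then $\left(\frac{a}{p}\right)=1$ and $\left(\frac{1-a}{p}\right)=-1$; if $A_2(a)^2=\frac{1}{1-a}$, then $\left(\frac{a}{p}\right)=-1$ and $\left(\frac{1-a}{p}\right)=1$; if $A_2(a)^2=\frac{a}{1-a}$, then $\left(\frac{a}{p}\right)=\left(\frac{1-a}{p}\right)=-1$.
   Context: $\left(\frac{\cdot}{p}\right)$ is the Legendre symbol. $A_2(x)=\frac12\left((1-\sqrt{x})^{(p-1)/2}+(1+\sqrt{x})^{(p-1)/2}\right)$, which is invariant under $\sqrt x\mapsto-\sqrt x$ and hence a polynomial in $x$ over $\mathbb{F}_p$; it is evaluated at $x=a$. -}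

module Defs where

open import Data.Bool.Base using (Bool; if_then_else_)
open import Data.Nat.Base as ℕ using (ℕ; zero; suc; NonZero; _≡ᵇ_)
open import Data.Nat.Combinatorics using (_C_)
open import Data.Integer.Base as ℤ using (ℤ; +_; _-_; _*_; _+_; _^_; _%ℕ_; 0ℤ; 1ℤ; -1ℤ)
open import Data.Integer.Divisibility using (_∣_)
open import Data.List.Base using (List; map; foldr; upTo)
open import Data.Bool.ListAction using (any)
open import Data.Product using (_×_)
open import Data.Sum using (_⊎_)
open import Relation.Nullary using (¬_)

-- Elements of F_p are represented by integers; equality in F_p is
-- congruence modulo p.
infix 4 _≡_[mod_]
_≡_[mod_] : ℤ → ℤ → ℕ → Set
x ≡ y [mod p ] = (+ p) ∣ (x - y)

legendre : (a : ℤ) (p : ℕ) .{{_ : NonZero p}} → ℤ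
legendre a p =
  if r ≡ᵇ 0 then 0ℤ
  else if any (λ x → ((x ℕ.* x) ℕ.% p) ≡ᵇ r) (upTo p) then 1ℤ
  else -1ℤ
  where r = a %ℕ p

-- A_2(x) = ½((1-√x)^m + (1+√x)^m), m = (p-1)/2.  By the binomial theorem
-- the odd powers of √x cancel, so A_2(x) = Σ_{j=0}^{m} C(m,2j) x^j
-- (terms with 2j > m vanish).
A₂ : (p : ℕ) → ℤ → ℤ
A₂ p x = foldr _+_ 0ℤ (map (λ j → + (m C (2 ℕ.* j)) * x ^ j) (upTo (suc m)))
  where m = (p ℕ.∸ 1) ℕ./ 2

ExactlyOne₄ : Set → Set → Set → Set → Set
ExactlyOne₄ P Q R S =
  (P ⊎ Q ⊎ R ⊎ S)
  × ¬ (P × Q) × ¬ (P × R) × ¬ (P × S)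
  × ¬ (Q × R) × ¬ (Q × S) × ¬ (R × S)

-- Write (1 + √x)ⁿ = P x n + Q x n · √x, so that A₂(a) = A := P a m and put B := Q a m,
-- where p = 2m + 1.  As p divides the binomial coefficients C(p, k) for 0 < k < p,
-- P a p ≡ 1 and Q a p ≡ a^m (mod p); expanding (1 + √a)^(m + m + 1) turns these into
-- N + 2aAB ≡ 1 and N + 2AB ≡ a^m with N = A² + aB², while the norm gives
-- A² - aB² = (1 - a)^m.  By Euler's criterion a^m and (1 - a)^m are ±1 according to the
-- Legendre symbols of a and 1 - a.  If a^m ≡ 1 then AB ≡ 0 and N ≡ 1, so either B ≡ 0
-- and A ≡ ±1, (1 - a)^m ≡ 1, or A ≡ 0 and (1 - a)^m ≡ -1.  If a^m ≡ -1 then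
-- 2A²(1 - a) ≡ 2 + (1 - a)((1 - a)^m - 1), i.e. A²(1 - a) ≡ 1 or a.  Since a ∉ {0, 1, ½}
-- the four outcomes exclude each other.  Fermat's little theorem is obtained from the same
-- congruences for P and Q, and Euler's criterion from Lagrange's bound on the roots of x^m - 1.
module Submission where

open import Data.Bool.Base using (Bool; true; false; T; if_then_else_)
open import Data.Bool.ListAction using (any)
open import Data.Empty using (⊥; ⊥-elim)
open import Data.Fin.Base using (Fin; zero; suc; toℕ)
import Data.Fin.Properties as Finₚ
open import Data.Integer.Base using (ℤ; +_; _+_; _-_; -_; _*_; _^_; 0ℤ; 1ℤ; -1ℤ; ∣_∣)
open import Data.Integer.Divisibility.Signed using (_∣_; divides; ∣ᵤ⇒∣; ∣⇒∣ᵤ; ∣n⇒∣m*n; ∣m∣n⇒∣m+n)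
open import Data.Integer.DivMod using (_%ℕ_; _/ℕ_; a≡a%ℕn+[a/ℕn]*n; n%ℕd<d)
import Data.Integer.Properties as ℤₚ
open import Data.Integer.Tactic.RingSolver using (solve; solve-∀)
open import Data.List.Base using ([]; _∷_; foldr; map; applyUpTo; upTo)
open import Data.List.Membership.Propositional using (lose)
open import Data.List.Membership.Propositional.Properties using (∈-upTo⁺)
open import Data.List.Relation.Unary.Any using (satisfied)
open import Data.List.Relation.Unary.Any.Properties using (any⁺; any⁻)
open import Data.Nat.Base as ℕ using (ℕ; zero; suc; _<_; z≤n; s≤s; NonZero; _!; _∸_; _≡ᵇ_)
open import Data.Nat.Combinatorics
  using (_C_; k>n⇒nCk≡0; nCk+nC[k+1]≡[n+1]C[k+1]; nCk≡n!/k![n-k]!; k![n∸k]!∣n!; nCn≡1)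
open import Data.Nat.Divisibility as ℕ using (>⇒∤; m∣m*n; ∣1⇒≡1)
open import Data.Nat.DivMod using (m/n*n≡m; m%n<n; m≡m%n+[m/n]*n)
open import Data.Nat.Primality
  using (Prime; ¬prime[1]; euclidsLemma; prime⇒nonZero; prime⇒nonTrivial; prime⇒irreducible)
import Data.Nat.Properties as ℕₚ
open import Data.Product using (_×_; _,_; ∃; uncurry; proj₁; proj₂)
open import Data.Sum as Sum using (_⊎_; inj₁; inj₂; [_,_]′)
open import Data.Vec.Base as Vec using (Vec; replicate)
open import Function.Base using (_∘_; id; flip; case_of_)
open import Function.Definitions using (Injective)
open import Level using (0ℓ)
open import Relation.Binary.Bundles using (Setoid)
open import Relation.Binary.Definitions using (tri<; tri≈; tri>)
open import Relation.Binary.PropositionalEquality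
import Relation.Binary.Reasoning.Setoid as SetoidReasoning
open import Relation.Nullary using (¬_; contradiction)

open import Algebra.Properties.Semiring.Sum ℤₚ.+-*-semiring
  using (sum-syntax; sum-cong-≗; ∑-distrib-+; *-distribˡ-sum; sum-replicate-zero)

open import Defs using (A₂; _≡_[mod_]; legendre; ExactlyOne₄)

foldr-+-applyUpTo : ∀ (f : ℕ → ℤ) (g : ℕ → ℕ) n →
  foldr _+_ 0ℤ (map f (applyUpTo g n)) ≡ ∑[ j < n ] f (g (toℕ j))
foldr-+-applyUpTo f g zero    = refl
foldr-+-applyUpTo f g (suc n) = cong (_+_ (f (g 0))) (foldr-+-applyUpTo f (g ∘ suc) n)

-- (1 + √x)ⁿ = P x n + Q x n · √x
P Q : ℤ → ℕ → ℤ
P x zero    = 1ℤ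
P x (suc n) = P x n + x * Q x n
Q x zero    = 0ℤ
Q x (suc n) = P x n + Q x n

even-term odd-term : ℤ → ℕ → ℕ → ℤ
even-term x n j = + (n C (2 ℕ.* j)) * x ^ j
odd-term  x n j = + (n C suc (2 ℕ.* j)) * x ^ j

2[1+j]≡2+2j : ∀ j → 2 ℕ.* suc j ≡ suc (suc (2 ℕ.* j))
2[1+j]≡2+2j j = cong suc (ℕₚ.+-suc j (j ℕ.+ 0))

pascal : ∀ n k → + (suc n C suc k) ≡ + (n C k) + + (n C suc k)
pascal n k = trans (cong +_ (sym (nCk+nC[k+1]≡[n+1]C[k+1] n k))) (ℤₚ.pos-+ (n C k) (n C suc k))

odd-term-suc : ∀ x n j → odd-term x (suc n) j ≡ even-term x n j + odd-term x n j
odd-term-suc x n j = begin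
  + (suc n C suc (2 ℕ.* j)) * x ^ j
    ≡⟨ cong (_* x ^ j) (pascal n (2 ℕ.* j)) ⟩
  (+ (n C (2 ℕ.* j)) + + (n C suc (2 ℕ.* j))) * x ^ j
    ≡⟨ ℤₚ.*-distribʳ-+ (x ^ j) (+ (n C (2 ℕ.* j))) (+ (n C suc (2 ℕ.* j))) ⟩
  even-term x n j + odd-term x n j ∎
  where open ≡-Reasoning

even-term-suc : ∀ x n j → even-term x (suc n) (suc j) ≡ x * odd-term x n j + even-term x n (suc j)
even-term-suc x n j = begin
  + (suc n C (2 ℕ.* suc j)) * x ^ suc j
    ≡⟨ cong (λ k → + (suc n C k) * x ^ suc j) (2[1+j]≡2+2j j) ⟩
  + (suc n C suc (suc (2 ℕ.* j))) * x ^ suc j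
    ≡⟨ cong (_* x ^ suc j) (pascal n (suc (2 ℕ.* j))) ⟩
  (+ (n C suc (2 ℕ.* j)) + + (n C suc (suc (2 ℕ.* j)))) * (x * x ^ j)
    ≡⟨ distrib (+ (n C suc (2 ℕ.* j))) (+ (n C suc (suc (2 ℕ.* j)))) x (x ^ j) ⟩
  x * odd-term x n j + + (n C suc (suc (2 ℕ.* j))) * x ^ suc j
    ≡⟨ cong (λ k → x * odd-term x n j + + (n C k) * x ^ suc j) (2[1+j]≡2+2j j) ⟨
  x * odd-term x n j + even-term x n (suc j) ∎
  where
  open ≡-Reasoning
  distrib : ∀ c d x y → (c + d) * (x * y) ≡ x * (c * y) + d * (x * y)
  distrib = solve-∀

P≡∑even-term : ∀ x n N → n < N → P x n ≡ ∑[ j < N ] even-term x n (toℕ j)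
Q≡∑odd-term : ∀ x n N → n < N → Q x n ≡ ∑[ j < N ] odd-term x n (toℕ j)

P≡∑even-term x zero (suc N) _ = cong (_+_ 1ℤ) (sym (sum-replicate-zero N))
P≡∑even-term x (suc n) (suc N) (s≤s n<N) = begin
  P x n + x * Q x n
    ≡⟨ cong₂ (λ s t → s + x * t) (P≡∑even-term x n (suc N) (ℕₚ.m<n⇒m<1+n n<N)) (Q≡∑odd-term x n N n<N) ⟩
  (1ℤ + ∑[ j < N ] even-term x n (suc (toℕ j))) + x * ∑[ j < N ] odd-term x n (toℕ j)
    ≡⟨ cong (_+_ (1ℤ + ∑[ j < N ] even-term x n (suc (toℕ j))))
            (*-distribˡ-sum {N} x (λ j → odd-term x n (toℕ j))) ⟩
  (1ℤ + ∑[ j < N ] even-term x n (suc (toℕ j))) + ∑[ j < N ] (x * odd-term x n (toℕ j))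
    ≡⟨ swap-summands 1ℤ _ (∑[ j < N ] (x * odd-term x n (toℕ j))) ⟩
  1ℤ + (∑[ j < N ] (x * odd-term x n (toℕ j)) + ∑[ j < N ] even-term x n (suc (toℕ j)))
    ≡⟨ cong (_+_ 1ℤ) (∑-distrib-+ {N} (λ j → x * odd-term x n (toℕ j))
                                      (λ j → even-term x n (suc (toℕ j)))) ⟨
  1ℤ + ∑[ j < N ] (x * odd-term x n (toℕ j) + even-term x n (suc (toℕ j)))
    ≡⟨ cong (_+_ 1ℤ) (sum-cong-≗ {N} (λ j → even-term-suc x n (toℕ j))) ⟨
  ∑[ j < suc N ] even-term x (suc n) (toℕ j) ∎
  where
  open ≡-Reasoning
  swap-summands : ∀ a b c → (a + b) + c ≡ a + (c + b)
  swap-summands = solve-∀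

Q≡∑odd-term x zero N _ = sym (sum-replicate-zero N)
Q≡∑odd-term x (suc n) N n+1<N = begin
  P x n + Q x n
    ≡⟨ cong₂ _+_ (P≡∑even-term x n N n<N) (Q≡∑odd-term x n N n<N) ⟩
  ∑[ j < N ] even-term x n (toℕ j) + ∑[ j < N ] odd-term x n (toℕ j)
    ≡⟨ ∑-distrib-+ {N} (λ j → even-term x n (toℕ j)) (λ j → odd-term x n (toℕ j)) ⟨
  ∑[ j < N ] (even-term x n (toℕ j) + odd-term x n (toℕ j))
    ≡⟨ sum-cong-≗ {N} (λ j → odd-term-suc x n (toℕ j)) ⟨
  ∑[ j < N ] odd-term x (suc n) (toℕ j) ∎
  where
  open ≡-Reasoning
  n<N : n < N
  n<N = ℕₚ.<⇒≤ n+1<N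

A₂≡P : ∀ p x → A₂ p x ≡ P x ((p ℕ.∸ 1) ℕ./ 2)
A₂≡P p x = trans (foldr-+-applyUpTo (even-term x m) id (suc m))
                 (sym (P≡∑even-term x m (suc m) (ℕₚ.n<1+n m)))
  where
  m : ℕ
  m = (p ℕ.∸ 1) ℕ./ 2

P²-xQ²≡[1-x]^n : ∀ x n → P x n * P x n - x * (Q x n * Q x n) ≡ (1ℤ - x) ^ n
P²-xQ²≡[1-x]^n x zero    = solve (x ∷ [])
P²-xQ²≡[1-x]^n x (suc n) = begin
  (P x n + x * Q x n) * (P x n + x * Q x n) - x * ((P x n + Q x n) * (P x n + Q x n))
    ≡⟨ norm-multiplicative x (P x n) (Q x n) ⟩
  (1ℤ - x) * (P x n * P x n - x * (Q x n * Q x n))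
    ≡⟨ cong ((1ℤ - x) *_) (P²-xQ²≡[1-x]^n x n) ⟩
  (1ℤ - x) * (1ℤ - x) ^ n ∎
  where
  open ≡-Reasoning
  norm-multiplicative : ∀ x u v →
    (u + x * v) * (u + x * v) - x * ((u + v) * (u + v)) ≡ (1ℤ - x) * (u * u - x * (v * v))
  norm-multiplicative = solve-∀

P-+ : ∀ x k n → P x (k ℕ.+ n) ≡ P x k * P x n + x * (Q x k * Q x n)
Q-+ : ∀ x k n → Q x (k ℕ.+ n) ≡ P x k * Q x n + Q x k * P x n

P-+ x zero    n = sym (unit x (P x n) (Q x n))
  where
  unit : ∀ x u v → 1ℤ * u + x * (0ℤ * v) ≡ u
  unit = solve-∀
P-+ x (suc k) n = begin
  P x (k ℕ.+ n) + x * Q x (k ℕ.+ n)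
    ≡⟨ cong₂ (λ s t → s + x * t) (P-+ x k n) (Q-+ x k n) ⟩
  (P x k * P x n + x * (Q x k * Q x n)) + x * (P x k * Q x n + Q x k * P x n)
    ≡⟨ regroup x (P x k) (Q x k) (P x n) (Q x n) ⟩
  (P x k + x * Q x k) * P x n + x * ((P x k + Q x k) * Q x n) ∎
  where
  open ≡-Reasoning
  regroup : ∀ x a b c d → (a * c + x * (b * d)) + x * (a * d + b * c) ≡ (a + x * b) * c + x * ((a + b) * d)
  regroup = solve-∀

Q-+ x zero    n = sym (unit (P x n) (Q x n))
  where
  unit : ∀ u v → 1ℤ * v + 0ℤ * u ≡ v
  unit = solve-∀
Q-+ x (suc k) n = begin
  P x (k ℕ.+ n) + Q x (k ℕ.+ n)
    ≡⟨ cong₂ _+_ (P-+ x k n) (Q-+ x k n) ⟩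
  (P x k * P x n + x * (Q x k * Q x n)) + (P x k * Q x n + Q x k * P x n)
    ≡⟨ regroup x (P x k) (Q x k) (P x n) (Q x n) ⟩
  (P x k + x * Q x k) * Q x n + (P x k + Q x k) * P x n ∎
  where
  open ≡-Reasoning
  regroup : ∀ x a b c d → (a * c + x * (b * d)) + (a * d + b * c) ≡ (a + x * b) * d + (a + b) * c
  regroup = solve-∀

[1+c]^n≡P+cQ : ∀ c n → (1ℤ + c) ^ n ≡ P (c * c) n + c * Q (c * c) n
[1+c]^n≡P+cQ c zero    = solve (c ∷ [])
[1+c]^n≡P+cQ c (suc n) = begin
  (1ℤ + c) * (1ℤ + c) ^ n
    ≡⟨ cong ((1ℤ + c) *_) ([1+c]^n≡P+cQ c n) ⟩
  (1ℤ + c) * (P (c * c) n + c * Q (c * c) n)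
    ≡⟨ expand c (P (c * c) n) (Q (c * c) n) ⟩
  P (c * c) n + c * c * Q (c * c) n + c * (P (c * c) n + Q (c * c) n) ∎
  where
  open ≡-Reasoning
  expand : ∀ c u v → (1ℤ + c) * (u + c * v) ≡ u + c * c * v + c * (u + v)
  expand = solve-∀

^-distribʳ-* : ∀ x y n → (x * y) ^ n ≡ x ^ n * y ^ n
^-distribʳ-* x y zero    = refl
^-distribʳ-* x y (suc n) =
  trans (cong ((x * y) *_) (^-distribʳ-* x y n)) (interchange x y (x ^ n) (y ^ n))
  where
  interchange : ∀ a b c d → a * b * (c * d) ≡ a * c * (b * d)
  interchange = solve-∀

n∣n! : ∀ n .{{_ : NonZero n}} → n ℕ.∣ n !
n∣n! (suc n) = m∣m*n (n !)

prime∤! : ∀ {p j} → Prime p → j ℕ.< p → p ℕ.∤ j !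
prime∤! {j = zero}  p-prime _   p∣1  = ¬prime[1] (subst Prime (∣1⇒≡1 p∣1) p-prime)
prime∤! {j = suc j} p-prime j<p p∣j! =
  [ >⇒∤ j<p , prime∤! p-prime (ℕₚ.<-trans (ℕₚ.n<1+n j) j<p) ]′ (euclidsLemma (suc j) (j !) p-prime p∣j!)

prime∣pCk : ∀ {p k} → Prime p → 0 ℕ.< k → k ≢ p → p ℕ.∣ p C k
prime∣pCk {p} {k} p-prime 0<k k≢p with ℕₚ.<-cmp k p
... | tri> _ _ p<k = subst (p ℕ.∣_) (sym (k>n⇒nCk≡0 p<k)) (p ℕ.∣0)
... | tri≈ _ k≡p _ = contradiction k≡p k≢p
... | tri< k<p _ _ =
  [ id , ⊥-elim ∘ p∤k!*[p∸k]! ]′ (euclidsLemma (p C k) (k ! ℕ.* (p ∸ k) !) p-prime p∣C*k!*[p∸k]!)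
  where
  instance
    p≢0 : NonZero p
    p≢0 = prime⇒nonZero p-prime
    k![p∸k]!≢0 : NonZero (k ! ℕ.* (p ∸ k) !)
    k![p∸k]!≢0 = ℕₚ._!*_!≢0 k (p ∸ k)
  C*k!*[p∸k]!≡p! : (p C k) ℕ.* (k ! ℕ.* (p ∸ k) !) ≡ p !
  C*k!*[p∸k]!≡p! = trans (cong (ℕ._* (k ! ℕ.* (p ∸ k) !)) (nCk≡n!/k![n-k]! (ℕₚ.<⇒≤ k<p)))
                        (m/n*n≡m (k![n∸k]!∣n! (ℕₚ.<⇒≤ k<p)))
  p∣C*k!*[p∸k]! : p ℕ.∣ (p C k) ℕ.* (k ! ℕ.* (p ∸ k) !)
  p∣C*k!*[p∸k]! = subst (p ℕ.∣_) (sym C*k!*[p∸k]!≡p!) (n∣n! p)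
  p∤k!*[p∸k]! : p ℕ.∤ k ! ℕ.* (p ∸ k) !
  p∤k!*[p∸k]! = [ prime∤! p-prime k<p , prime∤! p-prime (ℕₚ.∸-monoʳ-< 0<k (ℕₚ.<⇒≤ k<p)) ]′
              ∘ euclidsLemma (k !) ((p ∸ k) !) p-prime

monic : ∀ {d} → Vec ℤ d → ℤ → ℤ
monic Vec.[]       x = 1ℤ
monic (c Vec.∷ cs) x = c + x * monic cs x

monic-quotient : ∀ {d} → ℤ → Vec ℤ (suc d) → Vec ℤ d
monic-quotient r (c Vec.∷ Vec.[])      = Vec.[]
monic-quotient r (c Vec.∷ c′ Vec.∷ cs) = monic (c′ Vec.∷ cs) r Vec.∷ monic-quotient r (c′ Vec.∷ cs)

monic-division : ∀ {d} r (f : Vec ℤ (suc d)) x →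
                 monic f x ≡ (x - r) * monic (monic-quotient r f) x + monic f r
monic-division r (c Vec.∷ Vec.[])      x = linear r c x
  where
  linear : ∀ r c x → c + x * 1ℤ ≡ (x - r) * 1ℤ + (c + r * 1ℤ)
  linear = solve-∀
monic-division r (c Vec.∷ c′ Vec.∷ cs) x = begin
  c + x * monic (c′ Vec.∷ cs) x
    ≡⟨ cong (λ g → c + x * g) (monic-division r (c′ Vec.∷ cs) x) ⟩
  c + x * ((x - r) * monic (monic-quotient r (c′ Vec.∷ cs)) x + monic (c′ Vec.∷ cs) r)
    ≡⟨ regroup r c x (monic (monic-quotient r (c′ Vec.∷ cs)) x) (monic (c′ Vec.∷ cs) r) ⟩
  (x - r) * (monic (c′ Vec.∷ cs) r + x * monic (monic-quotient r (c′ Vec.∷ cs)) x)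
    + (c + r * monic (c′ Vec.∷ cs) r) ∎
  where
  open ≡-Reasoning
  regroup : ∀ r c x q g → c + x * ((x - r) * q + g) ≡ (x - r) * (g + x * q) + (c + r * g)
  regroup = solve-∀

xⁿ-1 : ∀ n .{{_ : NonZero n}} → Vec ℤ n
xⁿ-1 (suc k) = -1ℤ Vec.∷ replicate k 0ℤ

monic-xⁿ-1 : ∀ n .{{_ : NonZero n}} x → monic (xⁿ-1 n) x ≡ x ^ n - 1ℤ
monic-xⁿ-1 (suc k) x = trans (cong (λ y → -1ℤ + x * y) (monic-zeros k)) (ℤₚ.+-comm -1ℤ (x ^ suc k))
  where
  monic-zeros : ∀ k → monic (replicate k 0ℤ) x ≡ x ^ k
  monic-zeros zero    = refl
  monic-zeros (suc k) = trans (ℤₚ.+-identityˡ _) (cong (x *_) (monic-zeros k))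

module Congruence (n : ℕ) where

  infix 4 _≈_ _≉_

  -- A record rather than Defs._≡_[mod_], so that x and y can be inferred from x ≈ y.
  record _≈_ (x y : ℤ) : Set where
    constructor mk≈
    field
      divides-difference : + n ∣ x - y

  _≉_ : ℤ → ℤ → Set
  x ≉ y = ¬ x ≈ y

  ≡mod⇒≈ : ∀ {x y} → x ≡ y [mod n ] → x ≈ y
  ≡mod⇒≈ n∣x-y = mk≈ (∣ᵤ⇒∣ n∣x-y)

  ≈⇒≡mod : ∀ {x y} → x ≈ y → x ≡ y [mod n ]
  ≈⇒≡mod (mk≈ n∣x-y) = ∣⇒∣ᵤ n∣x-y

  -- Congruences are derived by exhibiting x - y as an integer combination of
  -- differences already known to be divisible by n; the combination itself is
  -- a ring identity, discharged by the solver at each use.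
  ≈-combination₁ : ∀ {x y x₁ y₁} c₁ → x₁ ≈ y₁ → x - y ≡ c₁ * (x₁ - y₁) → x ≈ y
  ≈-combination₁ c₁ (mk≈ d₁) eq = mk≈ (subst (+ n ∣_) (sym eq) (∣n⇒∣m*n c₁ d₁))

  ≈-combination₂ : ∀ {x y x₁ y₁ x₂ y₂} c₁ c₂ → x₁ ≈ y₁ → x₂ ≈ y₂ →
                   x - y ≡ c₁ * (x₁ - y₁) + c₂ * (x₂ - y₂) → x ≈ y
  ≈-combination₂ c₁ c₂ (mk≈ d₁) (mk≈ d₂) eq =
    mk≈ (subst (+ n ∣_) (sym eq) (∣m∣n⇒∣m+n (∣n⇒∣m*n c₁ d₁) (∣n⇒∣m*n c₂ d₂)))

  ≈-combination₃ : ∀ {x y x₁ y₁ x₂ y₂ x₃ y₃} c₁ c₂ c₃ → x₁ ≈ y₁ → x₂ ≈ y₂ → x₃ ≈ y₃ →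
                   x - y ≡ c₁ * (x₁ - y₁) + c₂ * (x₂ - y₂) + c₃ * (x₃ - y₃) → x ≈ y
  ≈-combination₃ c₁ c₂ c₃ (mk≈ d₁) (mk≈ d₂) (mk≈ d₃) eq =
    mk≈ (subst (+ n ∣_) (sym eq)
      (∣m∣n⇒∣m+n (∣m∣n⇒∣m+n (∣n⇒∣m*n c₁ d₁) (∣n⇒∣m*n c₂ d₂)) (∣n⇒∣m*n c₃ d₃)))

  ≈-multiple : ∀ {x y} k → x - y ≡ k * + n → x ≈ y
  ≈-multiple k eq = mk≈ (divides k eq)

  ≈-refl : ∀ {x} → x ≈ x
  ≈-refl {x} = ≈-multiple 0ℤ (solve (x ∷ []))

  ≈-reflexive : ∀ {x y} → x ≡ y → x ≈ y
  ≈-reflexive refl = ≈-refl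

  ≈-sym : ∀ {x y} → x ≈ y → y ≈ x
  ≈-sym {x} {y} x≈y = ≈-combination₁ -1ℤ x≈y (solve (x ∷ y ∷ []))

  ≈-trans : ∀ {x y z} → x ≈ y → y ≈ z → x ≈ z
  ≈-trans {x} {y} {z} x≈y y≈z = ≈-combination₂ 1ℤ 1ℤ x≈y y≈z (solve (x ∷ y ∷ z ∷ []))

  +-cong : ∀ {x y u v} → x ≈ y → u ≈ v → x + u ≈ y + v
  +-cong {x} {y} {u} {v} x≈y u≈v = ≈-combination₂ 1ℤ 1ℤ x≈y u≈v (solve (x ∷ y ∷ u ∷ v ∷ []))

  *-cong : ∀ {x y u v} → x ≈ y → u ≈ v → x * u ≈ y * v
  *-cong {x} {y} {u} {v} x≈y u≈v = ≈-combination₂ u y x≈y u≈v (solve (x ∷ y ∷ u ∷ v ∷ []))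

  -≈0⇒≈ : ∀ {x y} → x - y ≈ 0ℤ → x ≈ y
  -≈0⇒≈ {x} {y} x-y≈0 = ≈-combination₁ 1ℤ x-y≈0 (solve (x ∷ y ∷ []))

  ≈⇒-≈0 : ∀ {x y} → x ≈ y → x - y ≈ 0ℤ
  ≈⇒-≈0 {x} {y} x≈y = ≈-combination₁ 1ℤ x≈y (solve (x ∷ y ∷ []))

  +≈0⇒≈- : ∀ {x y} → x + y ≈ 0ℤ → x ≈ - y
  +≈0⇒≈- {x} {y} x+y≈0 = ≈-combination₁ 1ℤ x+y≈0 (solve (x ∷ y ∷ []))

  ≈-⇒+≈0 : ∀ {x y} → x ≈ - y → x + y ≈ 0ℤ
  ≈-⇒+≈0 {x} {y} x≈-y = ≈-combination₁ 1ℤ x≈-y (solve (x ∷ y ∷ []))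

  ^-cong : ∀ {x y} k → x ≈ y → x ^ k ≈ y ^ k
  ^-cong zero    x≈y = ≈-refl
  ^-cong (suc k) x≈y = *-cong x≈y (^-cong k x≈y)

  ≈-setoid : Setoid 0ℓ 0ℓ
  ≈-setoid = record
    { Carrier = ℤ ; _≈_ = _≈_
    ; isEquivalence = record { refl = ≈-refl ; sym = ≈-sym ; trans = ≈-trans } }

  module ≈-Reasoning = SetoidReasoning ≈-setoid

  ≈-residue : .{{_ : NonZero n}} → ∀ x → x ≈ + (x %ℕ n)
  ≈-residue x = ≈-multiple (x /ℕ n) (begin
    x - + (x %ℕ n)                           ≡⟨ cong (_- + (x %ℕ n)) (a≡a%ℕn+[a/ℕn]*n x n) ⟩
    + (x %ℕ n) + x /ℕ n * + n - + (x %ℕ n)   ≡⟨ cancel (+ (x %ℕ n)) (x /ℕ n * + n) ⟩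
    x /ℕ n * + n                             ∎)
    where
    open ≡-Reasoning
    cancel : ∀ r k → r + k - r ≡ k
    cancel = solve-∀

  residue-injective : ∀ {r s} → r ℕ.< n → s ℕ.< n → + r ≈ + s → r ≡ s
  residue-injective {r} {s} r<n s<n (mk≈ n∣r-s) =
    ℤₚ.+-injective (ℤₚ.i-j≡0⇒i≡j (+ r) (+ s) (ℤₚ.∣i∣≡0⇒i≡0 (∣∧<⇒≡0 (∣⇒∣ᵤ n∣r-s) ∣r-s∣<n)))
    where
    ∣∧<⇒≡0 : ∀ {k} → n ℕ.∣ k → k ℕ.< n → k ≡ 0
    ∣∧<⇒≡0 {zero}  _   _   = refl
    ∣∧<⇒≡0 {suc k} n∣k k<n = contradiction n∣k (>⇒∤ k<n)
    ∣r-s∣<n : ∣ + r - + s ∣ ℕ.< n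
    ∣r-s∣<n = subst (ℕ._< n) (cong ∣_∣ (sym (ℤₚ.[+m]-[+n]≡m⊖n r s)))
                (ℕₚ.≤-<-trans (ℤₚ.∣m⊝n∣≤m⊔n r s) (ℕₚ.⊔-lub r<n s<n))

  ≈⇒residue≡ : .{{_ : NonZero n}} → ∀ {x y} → x ≈ y → x %ℕ n ≡ y %ℕ n
  ≈⇒residue≡ {x} {y} x≈y = residue-injective (n%ℕd<d x n) (n%ℕd<d y n)
    (≈-trans (≈-sym (≈-residue x)) (≈-trans x≈y (≈-residue y)))

  ∑≈0 : ∀ {N} (f : ℕ → ℤ) → (∀ j → f j ≈ 0ℤ) → ∑[ j < N ] f (toℕ j) ≈ 0ℤ
  ∑≈0 {zero}  f f≈0 = ≈-refl
  ∑≈0 {suc N} f f≈0 = +-cong (f≈0 0) (∑≈0 {N} (f ∘ suc) (f≈0 ∘ suc))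

  ∑≈single-term : ∀ {N} (f : ℕ → ℤ) j₀ → j₀ ℕ.< N → (∀ j → j ≢ j₀ → f j ≈ 0ℤ) →
                  ∑[ j < N ] f (toℕ j) ≈ f j₀
  ∑≈single-term {suc N} f zero _ others≈0 = ≈-trans
    (+-cong (≈-refl {f 0}) (∑≈0 {N} (f ∘ suc) (λ j → others≈0 (suc j) λ ())))
    (≈-reflexive (ℤₚ.+-identityʳ (f 0)))
  ∑≈single-term {suc N} f (suc j₀) (s≤s j₀<N) others≈0 = ≈-trans
    (+-cong (others≈0 0 λ ())
      (∑≈single-term {N} (f ∘ suc) j₀ j₀<N λ j j≢j₀ → others≈0 (suc j) (j≢j₀ ∘ ℕₚ.suc-injective)))
    (≈-reflexive (ℤₚ.+-identityˡ (f (suc j₀))))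

module PrimeModulus (p : ℕ) (p-prime : Prime p) where

  open Congruence p public

  instance
    p≢0 : NonZero p
    p≢0 = prime⇒nonZero p-prime

  ≈0⇒p∣ : ∀ {x} → x ≈ 0ℤ → p ℕ.∣ ∣ x ∣
  ≈0⇒p∣ {x} (mk≈ p∣x-0) = subst (λ y → p ℕ.∣ ∣ y ∣) (ℤₚ.+-identityʳ x) (∣⇒∣ᵤ p∣x-0)

  p∣⇒≈0 : ∀ {x} → p ℕ.∣ ∣ x ∣ → x ≈ 0ℤ
  p∣⇒≈0 {x} p∣x = mk≈ (∣ᵤ⇒∣ (subst (λ y → p ℕ.∣ ∣ y ∣) (sym (ℤₚ.+-identityʳ x)) p∣x))

  *≈0⇒≈0⊎≈0 : ∀ {x y} → x * y ≈ 0ℤ → x ≈ 0ℤ ⊎ y ≈ 0ℤ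
  *≈0⇒≈0⊎≈0 {x} {y} xy≈0 = Sum.map p∣⇒≈0 p∣⇒≈0
    (euclidsLemma ∣ x ∣ ∣ y ∣ p-prime (subst (p ℕ.∣_) (ℤₚ.abs-* x y) (≈0⇒p∣ xy≈0)))

  *-cancelˡ-≈0 : ∀ {c x} → c ≉ 0ℤ → c * x ≈ 0ℤ → x ≈ 0ℤ
  *-cancelˡ-≈0 c≉0 cx≈0 = [ flip contradiction c≉0 , id ]′ (*≈0⇒≈0⊎≈0 cx≈0)

  +≉0 : ∀ {j} → 0 ℕ.< j → j ℕ.< p → + j ≉ 0ℤ
  +≉0 0<j j<p j≈0 = ℕₚ.<⇒≢ 0<j (sym (residue-injective j<p (ℕₚ.<-trans 0<j j<p) j≈0))

  1≉0 : 1ℤ ≉ 0ℤ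
  1≉0 = +≉0 (s≤s z≤n) (ℕ.nonTrivial⇒n>1 p {{prime⇒nonTrivial p-prime}})

  square≈square : ∀ {x y} → x * x ≈ y * y → x ≈ y ⊎ x ≈ - y
  square≈square {x} {y} x²≈y² = Sum.map -≈0⇒≈ +≈0⇒≈- (*≈0⇒≈0⊎≈0 [x-y][x+y]≈0)
    where
    [x-y][x+y]≈0 : (x - y) * (x + y) ≈ 0ℤ
    [x-y][x+y]≈0 = ≈-combination₁ 1ℤ x²≈y² (solve (x ∷ y ∷ []))

  factor-theorem : ∀ {d} {r} (f : Vec ℤ (suc d)) x → monic f r ≈ 0ℤ →
                   monic f x ≈ (x - r) * monic (monic-quotient r f) x
  factor-theorem {r = r} f x fr≈0 = ≈-trans (≈-reflexive (monic-division r f x))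
    (≈-trans (+-cong (≈-refl {(x - r) * q}) fr≈0) (≈-reflexive (ℤₚ.+-identityʳ ((x - r) * q))))
    where
    q : ℤ
    q = monic (monic-quotient r f) x

  lagrange : ∀ {d} (f : Vec ℤ d) (r : Fin (suc d) → ℤ) →
             (∀ i → monic f (r i) ≈ 0ℤ) → Injective _≡_ _≈_ r → ⊥
  lagrange Vec.[]      r roots r-inj = 1≉0 (roots zero)
  lagrange (c Vec.∷ f) r roots r-inj =
    lagrange (monic-quotient (r zero) (c Vec.∷ f)) (r ∘ suc) quotient-roots (Finₚ.suc-injective ∘ r-inj)
    where
    quotient-roots : ∀ i → monic (monic-quotient (r zero) (c Vec.∷ f)) (r (suc i)) ≈ 0ℤ
    quotient-roots i = *-cancelˡ-≈0 (Finₚ.0≢1+n ∘ sym ∘ r-inj ∘ -≈0⇒≈)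
      (≈-trans (≈-sym (factor-theorem (c Vec.∷ f) (r (suc i)) (roots zero))) (roots (suc i)))

  square-test : ℤ → ℕ → Bool
  square-test a x = (x ℕ.* x) ℕ.% p ≡ᵇ a %ℕ p

  square-test-complete : ∀ {a y} → y * y ≈ a → T (any (square-test a) (upTo p))
  square-test-complete {a} {y} y²≈a = any⁺ (square-test a)
    (lose (∈-upTo⁺ (n%ℕd<d y p)) (ℕₚ.≡⇒≡ᵇ _ _ (≈⇒residue≡ x²≈a)))
    where
    x : ℕ
    x = y %ℕ p
    x²≈a : + (x ℕ.* x) ≈ a
    x²≈a = ≈-trans (≈-reflexive (ℤₚ.pos-* x x))
             (≈-trans (*-cong (≈-sym (≈-residue y)) (≈-sym (≈-residue y))) y²≈a)

  square-test-sound : ∀ {a} → T (any (square-test a) (upTo p)) → ∃ λ y → y * y ≈ a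
  square-test-sound {a} found with satisfied (any⁻ (square-test a) (upTo p) found)
  ... | x , x²≡a = + x , ≈-trans (≈-reflexive (sym (ℤₚ.pos-* x x)))
      (≈-trans (≈-residue (+ (x ℕ.* x)))
        (≈-trans (≈-reflexive (cong +_ (ℕₚ.≡ᵇ⇒≡ _ _ x²≡a))) (≈-sym (≈-residue a))))

  legendre-nonzero : ∀ {a} → a ≉ 0ℤ →
                     legendre a p ≡ (if any (square-test a) (upTo p) then 1ℤ else -1ℤ)
  legendre-nonzero {a} a≉0 with a %ℕ p ≡ᵇ 0 in residue≡ᵇ0
  ... | false = refl
  ... | true  = contradiction
    (≈-trans (≈-residue a) (≈-reflexive (cong +_ (ℕₚ.≡ᵇ⇒≡ _ _ (subst T (sym residue≡ᵇ0) _))))) a≉0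

  legendre≡1 : ∀ {a} → a ≉ 0ℤ → ¬ (∀ y → y * y ≉ a) → legendre a p ≡ 1ℤ
  legendre≡1 {a} a≉0 ¬nonsquare with any (square-test a) (upTo p) in found | legendre-nonzero a≉0
  ... | true  | legendre≡ = legendre≡
  ... | false | _         =
    contradiction (λ y y²≈a → subst T found (square-test-complete {y = y} y²≈a)) ¬nonsquare

  legendre≡-1 : ∀ {a} → a ≉ 0ℤ → (∀ y → y * y ≉ a) → legendre a p ≡ -1ℤ
  legendre≡-1 {a} a≉0 nonsquare with any (square-test a) (upTo p) in found | legendre-nonzero a≉0
  ... | false | legendre≡ = legendre≡
  ... | true  | _         = ⊥-elim (uncurry nonsquare (square-test-sound (subst T (sym found) _)))

module OddPrime (p : ℕ) (p-prime : Prime p) (p≢2 : p ≢ 2) where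

  open PrimeModulus p p-prime public

  m : ℕ
  m = (p ∸ 1) ℕ./ 2

  p≡1+2m : p ≡ suc (2 ℕ.* m)
  p≡1+2m with (p ∸ 1) ℕ.% 2 | m%n<n (p ∸ 1) 2 | m≡m%n+[m/n]*n (p ∸ 1) 2
  ... | 0 | _ | p-1≡m*2 = trans (sym (ℕₚ.suc-pred p)) (cong suc (trans p-1≡m*2 (ℕₚ.*-comm m 2)))
  ... | 1 | _ | p-1≡1+m*2 = contradiction (prime⇒irreducible p-prime 2∣p) λ
    { (inj₁ ())
    ; (inj₂ 2≡p) → p≢2 (sym 2≡p) }
    where
    2∣p : 2 ℕ.∣ p
    2∣p = ℕ.divides (suc m) (trans (sym (ℕₚ.suc-pred p)) (cong suc p-1≡1+m*2))
  ... | suc (suc _) | s≤s (s≤s ()) | _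

  instance
    m≢0 : NonZero m
    m≢0 = ℕ.≢-nonZero λ m≡0 →
      ¬prime[1] (subst Prime (trans p≡1+2m (cong (λ k → suc (2 ℕ.* k)) m≡0)) p-prime)

  p∣c⇒c*x≈0 : ∀ {c} x → p ℕ.∣ c → + c * x ≈ 0ℤ
  p∣c⇒c*x≈0 {c} x p∣c = p∣⇒≈0 (subst (p ℕ.∣_) (sym (ℤₚ.abs-* (+ c) x)) (ℕ.∣m⇒∣m*n ∣ x ∣ p∣c))

  frobenius-P : ∀ x → P x p ≈ 1ℤ
  frobenius-P x = ≈-trans (≈-reflexive (P≡∑even-term x p (suc p) (ℕₚ.n<1+n p)))
    (∑≈single-term {suc p} (even-term x p) 0 (s≤s z≤n) vanishing)
    where
    vanishing : ∀ j → j ≢ 0 → even-term x p j ≈ 0ℤ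
    vanishing zero    j≢0 = contradiction refl j≢0
    vanishing (suc j) _   = p∣c⇒c*x≈0 (x ^ suc j) (prime∣pCk p-prime 0<2[1+j] 2[1+j]≢p)
      where
      0<2[1+j] : 0 ℕ.< 2 ℕ.* suc j
      0<2[1+j] = ℕₚ.m<m+n 0 (ℕₚ.m≤m+n 1 (j ℕ.+ suc (j ℕ.+ 0)))
      2[1+j]≢p : 2 ℕ.* suc j ≢ p
      2[1+j]≢p 2[1+j]≡p = ℕₚ.even≢odd (suc j) m (trans 2[1+j]≡p p≡1+2m)

  frobenius-Q : ∀ x → Q x p ≈ x ^ m
  frobenius-Q x = ≈-trans (≈-reflexive (Q≡∑odd-term x p (suc p) (ℕₚ.n<1+n p)))
    (≈-trans (∑≈single-term {suc p} (odd-term x p) m m<1+p vanishing) (≈-reflexive odd-term-m))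
    where
    m<1+p : m ℕ.< suc p
    m<1+p = s≤s (subst (m ℕ.≤_) (sym p≡1+2m) (ℕₚ.m≤n⇒m≤1+n (ℕₚ.m≤m+n m (m ℕ.+ 0))))
    vanishing : ∀ j → j ≢ m → odd-term x p j ≈ 0ℤ
    vanishing j j≢m = p∣c⇒c*x≈0 (x ^ j) (prime∣pCk p-prime (s≤s z≤n)
      (j≢m ∘ ℕₚ.*-cancelˡ-≡ j m 2 ∘ ℕₚ.suc-injective ∘ flip trans p≡1+2m))
    odd-term-m : odd-term x p m ≡ x ^ m
    odd-term-m = begin
      + (p C suc (2 ℕ.* m)) * x ^ m   ≡⟨ cong (λ k → + (p C k) * x ^ m) p≡1+2m ⟨
      + (p C p) * x ^ m               ≡⟨ cong (λ c → + c * x ^ m) (nCn≡1 p) ⟩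
      1ℤ * x ^ m                      ≡⟨ ℤₚ.*-identityˡ (x ^ m) ⟩
      x ^ m                           ∎
      where open ≡-Reasoning

  ^p≡*[x*x]^m : ∀ x → x ^ p ≡ x * (x * x) ^ m
  ^p≡*[x*x]^m x = begin
    x ^ p                     ≡⟨ cong (x ^_) p≡1+2m ⟩
    x * x ^ (m ℕ.+ (m ℕ.+ 0)) ≡⟨ cong (λ k → x * x ^ (m ℕ.+ k)) (ℕₚ.+-identityʳ m) ⟩
    x * x ^ (m ℕ.+ m)         ≡⟨ cong (x *_) (ℤₚ.^-distribˡ-+-* x m m) ⟩
    x * (x ^ m * x ^ m)       ≡⟨ cong (x *_) (^-distribʳ-* x x m) ⟨
    x * (x * x) ^ m           ∎
    where open ≡-Reasoning

  fermat : ∀ x → x ^ p ≈ x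
  fermat x = ≈-trans (^-cong p (≈-residue x)) (≈-trans (fermat-ℕ (x %ℕ p)) (≈-sym (≈-residue x)))
    where
    fermat-ℕ : ∀ c → (+ c) ^ p ≈ + c
    fermat-ℕ zero    = ≈-reflexive (^p≡*[x*x]^m 0ℤ)
    fermat-ℕ (suc c) = begin
      (1ℤ + + c) ^ p                            ≡⟨ [1+c]^n≡P+cQ (+ c) p ⟩
      P (+ c * + c) p + + c * Q (+ c * + c) p
        ≈⟨ +-cong (frobenius-P (+ c * + c)) (*-cong (≈-refl {+ c}) (frobenius-Q (+ c * + c))) ⟩
      1ℤ + + c * (+ c * + c) ^ m                ≡⟨ cong (_+_ 1ℤ) (^p≡*[x*x]^m (+ c)) ⟨
      1ℤ + (+ c) ^ p                            ≈⟨ +-cong (≈-refl {1ℤ}) (fermat-ℕ c) ⟩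
      1ℤ + + c                                  ∎
      where open ≈-Reasoning

  [x*x]^m≈1 : ∀ {x} → x ≉ 0ℤ → (x * x) ^ m ≈ 1ℤ
  [x*x]^m≈1 {x} x≉0 =
    -≈0⇒≈ (*-cancelˡ-≈0 x≉0 (≈-combination₁ 1ℤ (fermat x) (certificate (^p≡*[x*x]^m x))))
    where
    certificate : ∀ {x y z} → z ≡ x * y → x * (y - 1ℤ) - 0ℤ ≡ 1ℤ * (z - x)
    certificate {x} {y} refl = solve (x ∷ y ∷ [])

  x^m≈±1 : ∀ {x} → x ≉ 0ℤ → x ^ m ≈ 1ℤ ⊎ x ^ m ≈ -1ℤ
  x^m≈±1 {x} x≉0 = square≈square (≈-trans (≈-reflexive (sym (^-distribʳ-* x x m))) ([x*x]^m≈1 x≉0))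

  ≤m⇒<p : ∀ {i} → i ℕ.≤ m → i ℕ.< p
  ≤m⇒<p i≤m = subst (_ ℕ.<_) (sym p≡1+2m) (s≤s (ℕₚ.≤-trans i≤m (ℕₚ.m≤m+n m (m ℕ.+ 0))))

  2<p : 2 ℕ.< p
  2<p = subst (2 ℕ.<_) (sym p≡1+2m) (s≤s (ℕₚ.*-monoʳ-≤ 2 (ℕ.>-nonZero⁻¹ m)))

  2≉0 : + 2 ≉ 0ℤ
  2≉0 = +≉0 (s≤s z≤n) 2<p

  1≉-1 : 1ℤ ≉ -1ℤ
  1≉-1 1≈-1 = 2≉0 (≈-combination₁ 1ℤ 1≈-1 refl)

  squares-distinct : ∀ {i j} → 0 ℕ.< i → i ℕ.≤ m → j ℕ.≤ m → + i * + i ≈ + j * + j → i ≡ j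
  squares-distinct {i} {j} 0<i i≤m j≤m i²≈j² =
    [ residue-injective (≤m⇒<p i≤m) (≤m⇒<p j≤m) , ⊥-elim ∘ i+j≉0 ∘ ≈-⇒+≈0 ]′ (square≈square i²≈j²)
    where
    i+j≤2m : i ℕ.+ j ℕ.≤ 2 ℕ.* m
    i+j≤2m = ℕₚ.+-mono-≤ i≤m (subst (j ℕ.≤_) (sym (ℕₚ.+-identityʳ m)) j≤m)
    i+j≉0 : + i + + j ≉ 0ℤ
    i+j≉0 = subst (_≉ 0ℤ) (ℤₚ.pos-+ i j)
      (+≉0 (ℕₚ.<-≤-trans 0<i (ℕₚ.m≤m+n i j)) (subst (i ℕ.+ j ℕ.<_) (sym p≡1+2m) (s≤s i+j≤2m)))

  euler-criterion-residue : ∀ {a} → a ^ m ≈ 1ℤ → ¬ (∀ y → y * y ≉ a)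
  euler-criterion-residue {a} a^m≈1 nonsquare = lagrange (xⁿ-1 m) r roots r-injective
    where
    r : Fin (suc m) → ℤ
    r zero    = a
    r (suc i) = + suc (toℕ i) * + suc (toℕ i)
    root : ∀ {y} → y ^ m ≈ 1ℤ → monic (xⁿ-1 m) y ≈ 0ℤ
    root {y} y^m≈1 = ≈-trans (≈-reflexive (monic-xⁿ-1 m y)) (≈⇒-≈0 y^m≈1)
    roots : ∀ i → monic (xⁿ-1 m) (r i) ≈ 0ℤ
    roots zero    = root a^m≈1
    roots (suc i) = root ([x*x]^m≈1 (+≉0 (s≤s z≤n) (≤m⇒<p (Finₚ.toℕ<n i))))
    r-injective : Injective _≡_ _≈_ r
    r-injective {zero}  {zero}  _     = refl
    r-injective {zero}  {suc j} a≈j²  = ⊥-elim (nonsquare (+ suc (toℕ j)) (≈-sym a≈j²))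
    r-injective {suc i} {zero}  i²≈a  = ⊥-elim (nonsquare (+ suc (toℕ i)) i²≈a)
    r-injective {suc i} {suc j} i²≈j² = cong suc (Finₚ.toℕ-injective (ℕₚ.suc-injective
      (squares-distinct (s≤s z≤n) (Finₚ.toℕ<n i) (Finₚ.toℕ<n j) i²≈j²)))

  euler-criterion-nonresidue : ∀ {a} → a ≉ 0ℤ → a ^ m ≈ -1ℤ → ∀ y → y * y ≉ a
  euler-criterion-nonresidue {a} a≉0 a^m≈-1 y y²≈a =
    1≉-1 (≈-trans (≈-sym ([x*x]^m≈1 y≉0)) (≈-trans (^-cong m y²≈a) a^m≈-1))
    where
    y≉0 : y ≉ 0ℤ
    y≉0 y≈0 = a≉0 (≈-trans (≈-sym y²≈a) (*-cong y≈0 y≈0))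

  legendre-residue : ∀ {a} → a ≉ 0ℤ → a ^ m ≈ 1ℤ → legendre a p ≡ 1ℤ
  legendre-residue a≉0 a^m≈1 = legendre≡1 a≉0 (euler-criterion-residue a^m≈1)

  legendre-nonresidue : ∀ {a} → a ≉ 0ℤ → a ^ m ≈ -1ℤ → legendre a p ≡ -1ℤ
  legendre-nonresidue a≉0 a^m≈-1 = legendre≡-1 a≉0 (euler-criterion-nonresidue a≉0 a^m≈-1)

  p≡1+m+m : p ≡ suc (m ℕ.+ m)
  p≡1+m+m = trans p≡1+2m (cong (λ k → suc (m ℕ.+ k)) (ℕₚ.+-identityʳ m))

  P-at-p : ∀ x → P x p ≡ P x m * P x m + x * (Q x m * Q x m) + x * (P x m * Q x m + Q x m * P x m)
  P-at-p x = trans (cong (P x) p≡1+m+m) (cong₂ (λ s t → s + x * t) (P-+ x m m) (Q-+ x m m))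

  Q-at-p : ∀ x → Q x p ≡ P x m * P x m + x * (Q x m * Q x m) + (P x m * Q x m + Q x m * P x m)
  Q-at-p x = trans (cong (Q x) p≡1+m+m) (cong₂ _+_ (P-+ x m m) (Q-+ x m m))

  -- In the next two lemmas the first two hypotheses are frobenius-P a and frobenius-Q a
  -- expanded by P-at-p and Q-at-p, with A = P a m and B = Q a m.
  frobenius-residue-case : ∀ {a A B} → a ≉ 1ℤ →
    A * A + a * (B * B) + a * (A * B + B * A) ≈ 1ℤ →
    A * A + a * (B * B) + (A * B + B * A) ≈ 1ℤ →
    ((A ≈ 1ℤ ⊎ A ≈ -1ℤ) × A * A - a * (B * B) ≈ 1ℤ) ⊎ (A ≈ 0ℤ × A * A - a * (B * B) ≈ -1ℤ)
  frobenius-residue-case {a} {A} {B} a≉1 P-frob Q-frob =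
    Sum.swap (Sum.map A≈0-case B≈0-case (*≈0⇒≈0⊎≈0 AB≈0))
    where
    [a-1]2AB≈0 : (a - 1ℤ) * (+ 2 * (A * B)) ≈ 0ℤ
    [a-1]2AB≈0 = ≈-combination₂ 1ℤ -1ℤ P-frob Q-frob (solve (a ∷ A ∷ B ∷ []))
    AB≈0 : A * B ≈ 0ℤ
    AB≈0 = *-cancelˡ-≈0 2≉0 (*-cancelˡ-≈0 (a≉1 ∘ -≈0⇒≈) [a-1]2AB≈0)
    N≈1 : A * A + a * (B * B) ≈ 1ℤ
    N≈1 = ≈-combination₂ 1ℤ (- + 2) Q-frob AB≈0 (solve (a ∷ A ∷ B ∷ []))
    A≈0-case : A ≈ 0ℤ → A ≈ 0ℤ × A * A - a * (B * B) ≈ -1ℤ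
    A≈0-case A≈0 = A≈0 , ≈-combination₂ -1ℤ (+ 2 * A) N≈1 A≈0 (solve (a ∷ A ∷ B ∷ []))
    B≈0-case : B ≈ 0ℤ → (A ≈ 1ℤ ⊎ A ≈ -1ℤ) × A * A - a * (B * B) ≈ 1ℤ
    B≈0-case B≈0 = square≈square (≈-combination₂ 1ℤ (- (a * B)) N≈1 B≈0 (solve (a ∷ A ∷ B ∷ [])))
                 , ≈-combination₂ 1ℤ (- (+ 2 * a * B)) N≈1 B≈0 (solve (a ∷ A ∷ B ∷ []))

  frobenius-nonresidue-case : ∀ {a A B} →
    A * A + a * (B * B) + a * (A * B + B * A) ≈ 1ℤ →
    A * A + a * (B * B) + (A * B + B * A) ≈ -1ℤ →
    (A * A - a * (B * B) ≈ 1ℤ → A * A * (1ℤ - a) ≈ 1ℤ) ×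
    (A * A - a * (B * B) ≈ -1ℤ → A * A * (1ℤ - a) ≈ a)
  frobenius-nonresidue-case {a} {A} {B} P-frob Q-frob = β≈1-case , β≈-1-case
    where
    halve : ∀ {x y} → + 2 * (x - y) ≈ 0ℤ → x ≈ y
    halve = -≈0⇒≈ ∘ *-cancelˡ-≈0 2≉0
    β≈1-case : A * A - a * (B * B) ≈ 1ℤ → A * A * (1ℤ - a) ≈ 1ℤ
    β≈1-case β≈1 = halve (≈-combination₃ 1ℤ (- a) (1ℤ - a) P-frob Q-frob β≈1 (solve (a ∷ A ∷ B ∷ [])))
    β≈-1-case : A * A - a * (B * B) ≈ -1ℤ → A * A * (1ℤ - a) ≈ a
    β≈-1-case β≈-1 = halve (≈-combination₃ 1ℤ (- a) (1ℤ - a) P-frob Q-frob β≈-1 (solve (a ∷ A ∷ B ∷ [])))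

  module Alternatives (a A : ℤ) where

    A≡±1 A≡0 A²[1-a]≡1 A²[1-a]≡a : Set
    A≡±1      = A ≡ 1ℤ [mod p ] ⊎ A ≡ -1ℤ [mod p ]
    A≡0       = A ≡ 0ℤ [mod p ]
    A²[1-a]≡1 = A * A * (1ℤ - a) ≡ 1ℤ [mod p ]
    A²[1-a]≡a = A * A * (1ℤ - a) ≡ a [mod p ]

    Legendre : ℤ → ℤ → Set
    Legendre u v = legendre a p ≡ u × legendre (1ℤ - a) p ≡ v

    Classification : Set
    Classification = (A≡±1 × Legendre 1ℤ 1ℤ) ⊎ (A≡0 × Legendre 1ℤ -1ℤ)
                   ⊎ (A²[1-a]≡1 × Legendre -1ℤ 1ℤ) ⊎ (A²[1-a]≡a × Legendre -1ℤ -1ℤ)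

    A≡±1⇒A²≈1 : A≡±1 → A * A ≈ 1ℤ
    A≡±1⇒A²≈1 (inj₁ A≡1)  = *-cong {A} {1ℤ} {A} {1ℤ} (≡mod⇒≈ A≡1) (≡mod⇒≈ A≡1)
    A≡±1⇒A²≈1 (inj₂ A≡-1) = *-cong {A} { -1ℤ} {A} { -1ℤ} (≡mod⇒≈ A≡-1) (≡mod⇒≈ A≡-1)

    A≡0⇒A≈0 : A≡0 → A ≈ 0ℤ
    A≡0⇒A≈0 = ≡mod⇒≈

    A²[1-a]≡1⇒≈1 : A²[1-a]≡1 → A * A * (1ℤ - a) ≈ 1ℤ
    A²[1-a]≡1⇒≈1 = ≡mod⇒≈

    A²[1-a]≡a⇒≈a : A²[1-a]≡a → A * A * (1ℤ - a) ≈ a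
    A²[1-a]≡a⇒≈a = ≡mod⇒≈

    ±1∧0-impossible : ¬ (A≡±1 × A≡0)
    ±1∧0-impossible (A≡±1 , A≡0) =
      1≉0 (≈-combination₂ -1ℤ A (A≡±1⇒A²≈1 A≡±1) (A≡0⇒A≈0 A≡0) (solve (A ∷ [])))

    ±1∧A²[1-a]≡1-impossible : a ≉ 0ℤ → ¬ (A≡±1 × A²[1-a]≡1)
    ±1∧A²[1-a]≡1-impossible a≉0 (A≡±1 , A²[1-a]≡1) = a≉0
      (≈-combination₂ -1ℤ (1ℤ - a) (A²[1-a]≡1⇒≈1 A²[1-a]≡1) (A≡±1⇒A²≈1 A≡±1) (solve (a ∷ A ∷ [])))

    ±1∧A²[1-a]≡a-impossible : + 2 * a ≉ 1ℤ → ¬ (A≡±1 × A²[1-a]≡a)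
    ±1∧A²[1-a]≡a-impossible 2a≉1 (A≡±1 , A²[1-a]≡a) = 2a≉1
      (≈-combination₂ -1ℤ (1ℤ - a) (A²[1-a]≡a⇒≈a A²[1-a]≡a) (A≡±1⇒A²≈1 A≡±1) (solve (a ∷ A ∷ [])))

    0∧A²[1-a]≡1-impossible : ¬ (A≡0 × A²[1-a]≡1)
    0∧A²[1-a]≡1-impossible (A≡0 , A²[1-a]≡1) =
      1≉0 (≈-combination₂ -1ℤ (A * (1ℤ - a)) (A²[1-a]≡1⇒≈1 A²[1-a]≡1) (A≡0⇒A≈0 A≡0) (solve (a ∷ A ∷ [])))

    0∧A²[1-a]≡a-impossible : a ≉ 0ℤ → ¬ (A≡0 × A²[1-a]≡a)
    0∧A²[1-a]≡a-impossible a≉0 (A≡0 , A²[1-a]≡a) = a≉0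
      (≈-combination₂ -1ℤ (A * (1ℤ - a)) (A²[1-a]≡a⇒≈a A²[1-a]≡a) (A≡0⇒A≈0 A≡0) (solve (a ∷ A ∷ [])))

    A²[1-a]≡1∧≡a-impossible : a ≉ 1ℤ → ¬ (A²[1-a]≡1 × A²[1-a]≡a)
    A²[1-a]≡1∧≡a-impossible a≉1 (A²[1-a]≡1 , A²[1-a]≡a) = a≉1
      (≈-combination₂ 1ℤ -1ℤ (A²[1-a]≡1⇒≈1 A²[1-a]≡1) (A²[1-a]≡a⇒≈a A²[1-a]≡a) (solve (a ∷ A ∷ [])))

  classification : ∀ {a} → a ≉ 0ℤ → a ≉ 1ℤ → Alternatives.Classification a (A₂ p a)
  classification {a} a≉0 a≉1 =
    subst (Alternatives.Classification a) (sym (A₂≡P p a)) ([ residue , nonresidue ]′ (x^m≈±1 a≉0))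
    where
    open Alternatives a (P a m)
    A B : ℤ
    A = P a m
    B = Q a m
    1-a≉0 : 1ℤ - a ≉ 0ℤ
    1-a≉0 1-a≈0 = a≉1 (≈-sym (-≈0⇒≈ 1-a≈0))
    P-frob : A * A + a * (B * B) + a * (A * B + B * A) ≈ 1ℤ
    P-frob = ≈-trans (≈-reflexive (sym (P-at-p a))) (frobenius-P a)
    Q-frob : A * A + a * (B * B) + (A * B + B * A) ≈ a ^ m
    Q-frob = ≈-trans (≈-reflexive (sym (Q-at-p a))) (frobenius-Q a)
    β≈⇒ : ∀ {u} → A * A - a * (B * B) ≈ u → (1ℤ - a) ^ m ≈ u
    β≈⇒ = ≈-trans (≈-reflexive (sym (P²-xQ²≡[1-x]^n a m)))
    ⇒β≈ : ∀ {u} → (1ℤ - a) ^ m ≈ u → A * A - a * (B * B) ≈ u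
    ⇒β≈ = ≈-trans (≈-reflexive (P²-xQ²≡[1-x]^n a m))

    residue : a ^ m ≈ 1ℤ → Classification
    residue α≈1 = Sum.map case₁ (inj₁ ∘ case₂) (frobenius-residue-case a≉1 P-frob (≈-trans Q-frob α≈1))
      where
      case₁ : (A ≈ 1ℤ ⊎ A ≈ -1ℤ) × A * A - a * (B * B) ≈ 1ℤ → A≡±1 × Legendre 1ℤ 1ℤ
      case₁ (A≈±1 , β≈1) = Sum.map ≈⇒≡mod ≈⇒≡mod A≈±1
                         , legendre-residue a≉0 α≈1 , legendre-residue 1-a≉0 (β≈⇒ β≈1)
      case₂ : A ≈ 0ℤ × A * A - a * (B * B) ≈ -1ℤ → A≡0 × Legendre 1ℤ -1ℤ
      case₂ (A≈0 , β≈-1) = ≈⇒≡mod A≈0 , legendre-residue a≉0 α≈1 , legendre-nonresidue 1-a≉0 (β≈⇒ β≈-1)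

    nonresidue : a ^ m ≈ -1ℤ → Classification
    nonresidue α≈-1 = inj₂ (inj₂ (Sum.map case₃ case₄ (x^m≈±1 1-a≉0)))
      where
      β-cases : (A * A - a * (B * B) ≈ 1ℤ → A * A * (1ℤ - a) ≈ 1ℤ) ×
                (A * A - a * (B * B) ≈ -1ℤ → A * A * (1ℤ - a) ≈ a)
      β-cases = frobenius-nonresidue-case {a} {A} {B} P-frob (≈-trans Q-frob α≈-1)
      case₃ : (1ℤ - a) ^ m ≈ 1ℤ → A²[1-a]≡1 × Legendre -1ℤ 1ℤ
      case₃ β≈1 = ≈⇒≡mod (proj₁ β-cases (⇒β≈ β≈1))
                , legendre-nonresidue a≉0 α≈-1 , legendre-residue 1-a≉0 β≈1
      case₄ : (1ℤ - a) ^ m ≈ -1ℤ → A²[1-a]≡a × Legendre -1ℤ -1ℤ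
      case₄ β≈-1 = ≈⇒≡mod (proj₂ β-cases (⇒β≈ β≈-1))
                 , legendre-nonresidue a≉0 α≈-1 , legendre-nonresidue 1-a≉0 β≈-1

exactlyOne₄-of-cases : ∀ {P Q R S X Y Z W : Set} →
  (P × X) ⊎ (Q × Y) ⊎ (R × Z) ⊎ (S × W) →
  ¬ (P × Q) → ¬ (P × R) → ¬ (P × S) → ¬ (Q × R) → ¬ (Q × S) → ¬ (R × S) →
  ExactlyOne₄ P Q R S × (P → X) × (Q → Y) × (R → Z) × (S → W)
exactlyOne₄-of-cases {P} {Q} {R} {S} {X} {Y} {Z} {W} cases ¬PQ ¬PR ¬PS ¬QR ¬QS ¬RS =
  (Sum.map proj₁ (Sum.map proj₁ (Sum.map proj₁ proj₁)) cases , ¬PQ , ¬PR , ¬PS , ¬QR , ¬QS , ¬RS)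
  , P⇒X , Q⇒Y , R⇒Z , S⇒W
  where
  P⇒X : P → X
  P⇒X p = case cases of λ where
    (inj₁ (_ , x))               → x
    (inj₂ (inj₁ (q , _)))        → ⊥-elim (¬PQ (p , q))
    (inj₂ (inj₂ (inj₁ (r , _)))) → ⊥-elim (¬PR (p , r))
    (inj₂ (inj₂ (inj₂ (s , _)))) → ⊥-elim (¬PS (p , s))
  Q⇒Y : Q → Y
  Q⇒Y q = case cases of λ where
    (inj₁ (p , _))               → ⊥-elim (¬PQ (p , q))
    (inj₂ (inj₁ (_ , y)))        → y
    (inj₂ (inj₂ (inj₁ (r , _)))) → ⊥-elim (¬QR (q , r))
    (inj₂ (inj₂ (inj₂ (s , _)))) → ⊥-elim (¬QS (q , s))
  R⇒Z : R → Z
  R⇒Z r = case cases of λ where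
    (inj₁ (p , _))               → ⊥-elim (¬PR (p , r))
    (inj₂ (inj₁ (q , _)))        → ⊥-elim (¬QR (q , r))
    (inj₂ (inj₂ (inj₁ (_ , z)))) → z
    (inj₂ (inj₂ (inj₂ (s , _)))) → ⊥-elim (¬RS (r , s))
  S⇒W : S → W
  S⇒W s = case cases of λ where
    (inj₁ (p , _))               → ⊥-elim (¬PS (p , s))
    (inj₂ (inj₁ (q , _)))        → ⊥-elim (¬QS (q , s))
    (inj₂ (inj₂ (inj₁ (r , _)))) → ⊥-elim (¬RS (r , s))
    (inj₂ (inj₂ (inj₂ (_ , w)))) → w

proposition3p4 :
    (p : ℕ) .{{_ : NonZero p}} → Prime p → p ≢ 2 →
    (a : ℤ) → ¬ (a ≡ 0ℤ [mod p ]) → ¬ (a ≡ 1ℤ [mod p ]) →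
    ¬ (+ 2 * a ≡ 1ℤ [mod p ]) →
    let A = A₂ p a in
    ExactlyOne₄
      ((A ≡ 1ℤ [mod p ]) ⊎ (A ≡ -1ℤ [mod p ]))
      (A ≡ 0ℤ [mod p ])
      (A * A * (1ℤ - a) ≡ 1ℤ [mod p ])
      (A * A * (1ℤ - a) ≡ a [mod p ])
    × (((A ≡ 1ℤ [mod p ]) ⊎ (A ≡ -1ℤ [mod p ])) →
         (legendre a p ≡ 1ℤ) × (legendre (1ℤ - a) p ≡ 1ℤ))
    × ((A ≡ 0ℤ [mod p ]) →
         (legendre a p ≡ 1ℤ) × (legendre (1ℤ - a) p ≡ -1ℤ))
    × ((A * A * (1ℤ - a) ≡ 1ℤ [mod p ]) →
         (legendre a p ≡ -1ℤ) × (legendre (1ℤ - a) p ≡ 1ℤ))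
    × ((A * A * (1ℤ - a) ≡ a [mod p ]) →
         (legendre a p ≡ -1ℤ) × (legendre (1ℤ - a) p ≡ -1ℤ))
proposition3p4 p p-prime p≢2 a a≢0 a≢1 2a≢1 =
  exactlyOne₄-of-cases (classification a≉0 a≉1)
    ±1∧0-impossible (±1∧A²[1-a]≡1-impossible a≉0) (±1∧A²[1-a]≡a-impossible 2a≉1)
    0∧A²[1-a]≡1-impossible (0∧A²[1-a]≡a-impossible a≉0) (A²[1-a]≡1∧≡a-impossible a≉1)
  where
  open OddPrime p p-prime p≢2
  open Alternatives a (A₂ p a)
  a≉0 : a ≉ 0ℤ
  a≉0 = a≢0 ∘ ≈⇒≡mod
  a≉1 : a ≉ 1ℤ
  a≉1 = a≢1 ∘ ≈⇒≡mod
  2a≉1 : + 2 * a ≉ 1ℤ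
  2a≉1 = 2a≢1 ∘ ≈⇒≡mod
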